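{- Let $G=(V,E)$ be a graph with distinct vertex identifiers $\mathrm{ID}(v)$ and integer edge weights $w\colon E\to\{1,\dots,W\}$, let $p\in(0,1)$, $r\in\mathbb{N}$, and let $(\delta_v)_{v\in V}$ be any values in $\{0,1,\dots,r\}$. Define $d^{(u)}(s,x):=r-\delta_u+d_G(u,x)$, $d'(x):=\min_{u\in V}d^{(u)}(s,x)$, and let $c_x$ be the vertex $u$ of minimal $\mathrm{ID}$ among those with $d^{(u)}(s,x)=d'(x)$; clusters are the sets $\{x: c_x=v\}$. Then every cluster $U$ has strong diameter at most $2r$, i.e. $d_{G[U]}(a,b)\le 2r$ for all $a,b\in U$.
   Context: $d_G$ is weighted shortest-path distance; $G[U]$ is the subgraph induced by $U$. -}

module Defs where

open import Data.Nat using (ℕ; zero; suc; _+_; _∸_; _≤_; _<_)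
open import Data.Fin using (Fin)
open import Data.Unit using (⊤)
open import Data.Maybe using (Maybe; just; nothing)
open import Data.Product using (Σ; _×_; _,_; ∃)
open import Relation.Binary.PropositionalEquality using (_≡_)

-- A weighted undirected graph on vertex set Fin n.
-- w u v ≡ just k  means {u,v} is an edge of weight k; nothing means no edge.
record WGraph (n W : ℕ) : Set where
  field
    w     : Fin n → Fin n → Maybe ℕ
    symm  : ∀ u v → w u v ≡ w v u
    wt-lo : ∀ u v k → w u v ≡ just k → 1 ≤ k
    wt-hi : ∀ u v k → w u v ≡ just k → k ≤ W

open WGraph public

-- Walk G P a b ℓ : a walk from a to b of total weight ℓ, all of whose
-- vertices satisfy P (i.e. a walk in the induced subgraph G[P]).
data Walk {n W : ℕ} (G : WGraph n W) (P : Fin n → Set) : Fin n → Fin n → ℕ → Set where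
  nil  : ∀ {a} → P a → Walk G P a a 0
  cons : ∀ {a b c k ℓ} → P a → w G a b ≡ just k → Walk G P b c ℓ → Walk G P a c (k + ℓ)

All : {n : ℕ} → Fin n → Set
All _ = ⊤

IsDist : {n W : ℕ} → WGraph n W → (Fin n → Set) → Fin n → Fin n → ℕ → Set
IsDist G P a b d = Walk G P a b d × (∀ ℓ → Walk G P a b ℓ → d ≤ ℓ)

DistLe : {n W : ℕ} → WGraph n W → (Fin n → Set) → Fin n → Fin n → ℕ → Set
DistLe G P a b k = Σ ℕ λ ℓ → Walk G P a b ℓ × ℓ ≤ k

DU : {n W : ℕ} → WGraph n W → ℕ → (Fin n → ℕ) → Fin n → Fin n → ℕ → Set
DU G r δ u x e = Σ ℕ λ d → IsDist G All u x d × e ≡ (r ∸ δ u) + d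

-- c_x = c : c attains the minimum d'(x) = min_u d^{(u)}(s,x), and among all minimisers
-- it has the minimal ID.  (Vertices u with d_G(u,x) = ∞ never attain the minimum.)
IsCenter : {n W : ℕ} → WGraph n W → ℕ → (Fin n → ℕ) → (Fin n → ℕ) → Fin n → Fin n → Set
IsCenter G r δ ID x c =
  Σ ℕ λ e → DU G r δ c x e
    × (∀ u e' → DU G r δ u x e' → e ≤ e')
    × (∀ u → DU G r δ u x e → ID c ≤ ID u)

Cluster : {n W : ℕ} → WGraph n W → ℕ → (Fin n → ℕ) → (Fin n → ℕ) → Fin n → Fin n → Set
Cluster G r δ ID v x = IsCenter G r δ ID x v

-- If x lies in the cluster of v, every vertex y on a shortest v–x path lies there too:
-- d^(u)(y) + d(y,x) ≥ d^(u)(x) ≥ d^(v)(x) = d^(v)(y) + d(y,x) for every u, so v is still a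
-- minimiser at y, and a tie at y would be a tie at x.  Hence the shortest v–x path runs inside
-- the cluster, and it has weight d(v,x) ≤ d^(v)(x) ≤ d^(x)(x) = r − δ_x ≤ r.  Two such paths
-- through v join any two members of the cluster.
module Submission where

open import Defs
open import Data.Nat using (ℕ; _≤_; _*_)
open import Data.Fin using (Fin)
open import Data.Rational using (ℚ; 0ℚ; 1ℚ) renaming (_<_ to _<ℚ_)
open import Function.Definitions using (Injective)
open import Relation.Binary.PropositionalEquality using (_≡_)

open import Data.Nat using (_+_; _∸_; _<_; z≤n; _≤?_)
open import Data.Nat.Induction using (<-rec)
open import Data.Nat.Properties
open import Data.Fin.Properties using (any?) renaming (_≟_ to _≟ᶠ_)
open import Data.Maybe using (just; nothing)
open import Data.Product using (Σ; _×_; _,_; ∃; proj₁; proj₂)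
open import Data.Sum using (_⊎_; inj₁; inj₂)
open import Data.Unit using (tt)
open import Function.Bundles using (_⇔_; mk⇔; Equivalence)
open import Relation.Nullary using (Dec; yes; no)
open import Relation.Nullary.Decidable using (map′; _×-dec_; _⊎-dec_)
open import Relation.Unary using (Pred; Decidable)
open import Relation.Binary.PropositionalEquality using (refl; sym; cong; subst)

IsLeast : ∀ {p} → Pred ℕ p → ℕ → Set p
IsLeast Q d = Q d × (∀ m → Q m → d ≤ m)

least : ∀ {p} {Q : Pred ℕ p} → Decidable Q → ∀ {m} → Q m → ∃ (IsLeast Q)
least {Q = Q} Q? {m} = <-rec (λ m → Q m → ∃ (IsLeast Q)) step m
  where
  step : ∀ m → (∀ {m′} → m′ < m → Q m′ → ∃ (IsLeast Q)) → Q m → ∃ (IsLeast Q)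
  step m rec qm with anyUpTo? Q? m
  ... | yes (m′ , m′<m , qm′) = rec m′<m qm′
  ... | no none = m , qm , λ m′ qm′ → ≮⇒≥ λ m′<m → none (m′ , m′<m , qm′)

module _ {n W : ℕ} (G : WGraph n W) where

  _++_ : ∀ {P a b c l₁ l₂} → Walk G P a b l₁ → Walk G P b c l₂ → Walk G P a c (l₁ + l₂)
  nil _ ++ q = q
  _++_ {l₂ = l₂} (cons {k = k} {ℓ = ℓ} pa e p) q =
    subst (Walk G _ _ _) (sym (+-assoc k ℓ l₂)) (cons pa e (p ++ q))

  last : ∀ {P a b l} → Walk G P a b l → P b
  last (nil pa)     = pa
  last (cons _ _ p) = last p

  snoc : ∀ {P a b c l k} → Walk G P a b l → w G b c ≡ just k → P c → Walk G P a c (l + k)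
  snoc {l = l} {k} p e pc =
    subst (Walk G _ _ _) (cong (l +_) (+-identityʳ k)) (p ++ cons (last p) e (nil pc))

  reverse : ∀ {P a b l} → Walk G P a b l → Walk G P b a l
  reverse (nil pa) = nil pa
  reverse {a = a} (cons {b = b} {k = k} {ℓ = ℓ} pa e p) =
    subst (Walk G _ _ _) (+-comm ℓ k) (snoc (reverse p) (subst (_≡ just k) (symm G a b) e) pa)

  IsDist-unique : ∀ {P a b d d′} → IsDist G P a b d → IsDist G P a b d′ → d ≡ d′
  IsDist-unique (p , min) (p′ , min′) = ≤-antisym (min _ p′) (min′ _ p)

  DistLeThrough : (Fin n → Set) → ℕ → Fin n → Fin n → Fin n → Set
  DistLeThrough P m a b c = Σ ℕ λ j → w G a c ≡ just j × j ≤ m × DistLe G P c b (m ∸ j)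

  DistLe-unfold : ∀ {P a b m} → DistLe G P a b m ⇔ (P a × (a ≡ b ⊎ ∃ (DistLeThrough P m a b)))
  DistLe-unfold {P} {a} {b} {m} = mk⇔ to from
    where
    to : DistLe G P a b m → P a × (a ≡ b ⊎ ∃ (DistLeThrough P m a b))
    to (_ , nil pa , _) = pa , inj₁ refl
    to (_ , cons {b = c} {k = j} {ℓ = ℓ} pa e q , le) =
      pa , inj₂ (c , j , e , ≤-trans (m≤m+n j ℓ) le ,
                 ℓ , q , m+n≤o⇒m≤o∸n ℓ (subst (_≤ m) (+-comm j ℓ) le))
    from : P a × (a ≡ b ⊎ ∃ (DistLeThrough P m a b)) → DistLe G P a b m
    from (pa , inj₁ refl) = 0 , nil pa , z≤n
    from (pa , inj₂ (c , j , e , j≤m , ℓ , q , le)) =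
      j + ℓ , cons pa e q , subst (_≤ m) (+-comm ℓ j) (m≤o∸n⇒m+n≤o ℓ j≤m le)

  -- Recursion on the budget: edge weights are ≥ 1, so the budget m ∸ j left after the first
  -- edge is smaller than m.
  distLe? : ∀ {P} → Decidable P → ∀ m a b → Dec (DistLe G P a b m)
  distLe? {P} P? = <-rec (λ m → ∀ a b → Dec (DistLe G P a b m)) step
    where
    step : ∀ m → (∀ {m′} → m′ < m → ∀ a b → Dec (DistLe G P a b m′)) → ∀ a b → Dec (DistLe G P a b m)
    step m rec a b = map′ from to (P? a ×-dec (a ≟ᶠ b ⊎-dec any? via))
      where
      open Equivalence (DistLe-unfold {P} {a} {b} {m})
      via : ∀ c → Dec (DistLeThrough P m a b c)
      via c with w G a c in e
      ... | nothing = no λ ()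
      ... | just j with j ≤? m
      ...   | no j≰m  = no λ { (_ , refl , j≤m , _) → j≰m j≤m }
      ...   | yes j≤m = map′ (λ d → j , refl , j≤m , d) (λ { (_ , refl , _ , d) → d })
                             (rec (∸-monoʳ-< (wt-lo G a c j e) j≤m) c b)

  shortest : ∀ {P a b l} → Decidable P → Walk G P a b l → Σ ℕ λ d → IsDist G P a b d × d ≤ l
  shortest {a = a} {b} {l} P? p with least (λ m → distLe? P? m a b) (l , p , ≤-refl)
  ... | d , (ℓ , q , ℓ≤d) , d-least =
    ℓ , (q , λ ℓ′ q′ → ≤-trans ℓ≤d (d-least ℓ′ (ℓ′ , q′ , ≤-refl))) ,
    ≤-trans ℓ≤d (d-least l (l , p , ≤-refl))

  all? : Decidable (All {n})
  all? _ = yes tt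

  module Clusters (r : ℕ) (δ ID : Fin n → ℕ) where

    offset : Fin n → ℕ
    offset u = r ∸ δ u

    cluster-geodesic-prefix : ∀ {v x y l₁ l₂} → Cluster G r δ ID v x
      → Walk G All v y l₁ → Walk G All y x l₂ → IsDist G All v x (l₁ + l₂)
      → Cluster G r δ ID v y
    cluster-geodesic-prefix {v} {x} {y} {l₁} {l₂}
      (_ , (d , dist-vx , refl) , minimal , tiebreak) pre suf geodesic
      with IsDist-unique dist-vx geodesic
    ... | refl = offset v + l₁ , (l₁ , dist-vy , refl) , minimal-y , tiebreak-y
      where
      open ≤-Reasoning

      dist-vy : IsDist G All v y l₁
      dist-vy = pre , λ ℓ q → +-cancelʳ-≤ l₂ l₁ ℓ (proj₂ geodesic (ℓ + l₂) (q ++ suf))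

      through-y : ∀ {u du} → IsDist G All u y du
        → Σ ℕ λ dux → IsDist G All u x dux × offset u + dux ≤ (offset u + du) + l₂
      through-y {u} {du} (q , _) with shortest all? (q ++ suf)
      ... | dux , dist-ux , dux≤ = dux , dist-ux , (begin
        offset u + dux        ≤⟨ +-monoʳ-≤ (offset u) dux≤ ⟩
        offset u + (du + l₂)  ≡⟨ +-assoc (offset u) du l₂ ⟨
        (offset u + du) + l₂  ∎)

      minimal-y : ∀ u e → DU G r δ u y e → offset v + l₁ ≤ e
      minimal-y u _ (du , dist-uy , refl) with through-y dist-uy
      ... | dux , dist-ux , via-y = +-cancelʳ-≤ l₂ _ _ (begin
        (offset v + l₁) + l₂  ≡⟨ +-assoc (offset v) l₁ l₂ ⟩
        offset v + (l₁ + l₂)  ≤⟨ minimal u _ (dux , dist-ux , refl) ⟩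
        offset u + dux        ≤⟨ via-y ⟩
        (offset u + du) + l₂  ∎)

      tiebreak-y : ∀ u → DU G r δ u y (offset v + l₁) → ID v ≤ ID u
      tiebreak-y u (du , dist-uy , tie) with through-y dist-uy
      ... | dux , dist-ux , via-y =
        tiebreak u (dux , dist-ux , ≤-antisym (minimal u _ (dux , dist-ux , refl)) (begin
          offset u + dux        ≤⟨ via-y ⟩
          (offset u + du) + l₂  ≡⟨ cong (_+ l₂) tie ⟨
          (offset v + l₁) + l₂  ≡⟨ +-assoc (offset v) l₁ l₂ ⟩
          offset v + (l₁ + l₂)  ∎))

    geodesic-in-cluster : ∀ {v x y l₁ l₂} → Cluster G r δ ID v x
      → Walk G All v y l₁ → Walk G All y x l₂ → IsDist G All v x (l₁ + l₂)
      → Walk G (Cluster G r δ ID v) y x l₂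
    geodesic-in-cluster cx pre suf@(nil _) geodesic =
      nil (cluster-geodesic-prefix cx pre suf geodesic)
    geodesic-in-cluster {l₁ = l₁} cx pre suf@(cons {k = k} {ℓ = ℓ} _ e rest) geodesic =
      cons (cluster-geodesic-prefix cx pre suf geodesic) e
        (geodesic-in-cluster cx (snoc pre e tt) rest
          (subst (IsDist G All _ _) (sym (+-assoc l₁ k ℓ)) geodesic))

    cluster-near-center : ∀ {v x} → Cluster G r δ ID v x
      → Σ ℕ λ d → Walk G (Cluster G r δ ID v) v x d × d ≤ r
    cluster-near-center {v} {x} cx@(_ , (d , dist-vx , refl) , minimal , _) =
      d , geodesic-in-cluster cx (nil tt) (proj₁ dist-vx) dist-vx , (begin
        d                 ≤⟨ m≤n+m d (offset v) ⟩
        offset v + d      ≤⟨ minimal x _ (0 , (nil tt , λ _ _ → z≤n) , refl) ⟩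
        offset x + 0      ≡⟨ +-identityʳ (offset x) ⟩
        r ∸ δ x           ≤⟨ m∸n≤m r (δ x) ⟩
        r                 ∎)
      where open ≤-Reasoning

corollary8 : (n W : ℕ) (G : WGraph n W) (ID : Fin n → ℕ) → Injective _≡_ _≡_ ID
    → (p : ℚ) → 0ℚ <ℚ p → p <ℚ 1ℚ
    → (r : ℕ) (δ : Fin n → ℕ) → (∀ v → δ v ≤ r)
    → ∀ v a b → Cluster G r δ ID v a → Cluster G r δ ID v b
    → DistLe G (Cluster G r δ ID v) a b (2 * r)
corollary8 n W G ID _ _ _ _ r δ _ v a b ca cb
  with Clusters.cluster-near-center G r δ ID ca | Clusters.cluster-near-center G r δ ID cb
... | da , va , da≤r | db , vb , db≤r =
  da + db , _++_ G (reverse G va) vb , +-mono-≤ da≤r (≤-trans db≤r (m≤m+n r 0))
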